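{- Let $m\ge 1$ be an integer and let $\Gamma$ be a strongly regular bicirculant with parameters $(2(2m^2+2m+1),\,m(2m+1),\,m^2-1,\,m^2)$. Then for every vertex $x$ of $\Gamma$, $\Gamma$ is not locally $3$-isoregular at $x$.
   Context: All graphs are finite, simple and connected. A strongly regular graph with parameters $(N,k,\lambda,\mu)$ is a $k$-regular graph on $N$ vertices in which adjacent vertices have exactly $\lambda$ common neighbours and distinct non-adjacent vertices have exactly $\mu$ common neighbours. A bicirculant is a graph on $2n$ vertices admitting an automorphism whose cycle decomposition consists of exactly two cycles of length $n$. For a vertex set $T$, the valency of $T$ is the number of vertices adjacent to every vertex of $T$. An ordered pair $(x,y)$ of distinct vertices is $3$-isoregular if for all vertices $z\ne x,y$ the valency of $\{x,y,z\}$ depends only on the isomorphism type of the subgraph induced on $\{x,y,z\}$. A graph is locally $3$-isoregular at a vertex $x$ if there exist a neighbour $y$ of $x$ and a non-neighbour $z\ne x$ of $x$ such that both $(x,y)$ and $(x,z)$ are $3$-isoregular. -}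

module Defs where

open import Data.Nat using (ℕ; zero; suc; _+_; _*_; _∸_)
open import Data.Bool using (Bool; true; false; _∧_; if_then_else_)
open import Data.Fin using (Fin)
open import Data.List using (List; allFin; map)
open import Data.Nat.ListAction using (sum)
open import Data.Product using (Σ; ∃; _×_; _,_)
open import Data.Sum using (_⊎_)
open import Function using (_∘_; id)
open import Function.Bundles using (Inverse; _↔_)
open import Relation.Binary.PropositionalEquality using (_≡_; _≢_)

Adjacency : ℕ → Set
Adjacency N = Fin N → Fin N → Bool

data Reach {N : ℕ} (adj : Adjacency N) : Fin N → Fin N → Set where
  here : ∀ {x} → Reach adj x x
  step : ∀ {x y z} → adj x y ≡ true → Reach adj y z → Reach adj x z

record IsGraph {N : ℕ} (adj : Adjacency N) : Set where
  field
    symmetric   : ∀ x y → adj x y ≡ adj y x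
    irreflexive : ∀ x → adj x x ≡ false
    connected   : ∀ x y → Reach adj x y

count : ∀ {N : ℕ} → (Fin N → Bool) → ℕ
count {N} p = sum (map (λ w → if p w then 1 else 0) (allFin N))

degree : ∀ {N : ℕ} → Adjacency N → Fin N → ℕ
degree adj x = count (adj x)

common₂ : ∀ {N : ℕ} → Adjacency N → Fin N → Fin N → ℕ
common₂ adj x y = count (λ w → adj x w ∧ adj y w)

valency₃ : ∀ {N : ℕ} → Adjacency N → Fin N → Fin N → Fin N → ℕ
valency₃ adj x y z = count (λ w → adj x w ∧ adj y w ∧ adj z w)

record IsSRG {N : ℕ} (adj : Adjacency N) (k l μ : ℕ) : Set where
  field
    regular    : ∀ x → degree adj x ≡ k
    adjacentλ  : ∀ x y → adj x y ≡ true → common₂ adj x y ≡ l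
    nonadjμ    : ∀ x y → x ≢ y → adj x y ≡ false → common₂ adj x y ≡ μ

iter : ∀ {A : Set} → ℕ → (A → A) → A → A
iter zero    f = id
iter (suc n) f = f ∘ iter n f

IsAutomorphism : ∀ {N : ℕ} → Adjacency N → (Fin N ↔ Fin N) → Set
IsAutomorphism adj σ = ∀ x y → adj (Inverse.to σ x) (Inverse.to σ y) ≡ adj x y

-- The cycle decomposition of the permutation σ of Fin (2n) consists of exactly
-- two cycles of length n: there are u, v such that σⁿ u = u, σⁿ v = v, the 2n
-- vertices σⁱ u, σⁱ v (i < n) are pairwise distinct and they exhaust Fin (2n).
TwoCyclesOfLength : (n : ℕ) → (Fin (n + n) ↔ Fin (n + n)) → Set
TwoCyclesOfLength n σ =
  Σ (Fin (n + n)) λ u → Σ (Fin (n + n)) λ v →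
    (iter n s u ≡ u) × (iter n s v ≡ v) ×
    (∀ (i j : Fin n) → orb u v i j) ×
    (∀ w → (Σ (Fin n) λ i → iter (Data.Fin.toℕ i) s u ≡ w)
         ⊎ (Σ (Fin n) λ i → iter (Data.Fin.toℕ i) s v ≡ w))
  where
  s = Inverse.to σ
  open import Data.Fin using (toℕ)
  orb : Fin (n + n) → Fin (n + n) → Fin n → Fin n → Set
  orb u v i j =
    (iter (toℕ i) s u ≡ iter (toℕ j) s u → i ≡ j) ×
    (iter (toℕ i) s v ≡ iter (toℕ j) s v → i ≡ j) ×
    (iter (toℕ i) s u ≢ iter (toℕ j) s v)

IsBicirculant : (n : ℕ) → Adjacency (n + n) → Set
IsBicirculant n adj =
  Σ (Fin (n + n) ↔ Fin (n + n)) λ σ → IsAutomorphism adj σ × TwoCyclesOfLength n σ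

triple : ∀ {N : ℕ} → Fin N → Fin N → Fin N → Fin 3 → Fin N
triple a b c Fin.zero = a
triple a b c (Fin.suc Fin.zero) = b
triple a b c (Fin.suc (Fin.suc Fin.zero)) = c

InducedIso₃ : ∀ {N : ℕ} → Adjacency N → (Fin N × Fin N × Fin N) → (Fin N × Fin N × Fin N) → Set
InducedIso₃ adj (x , y , z) (x' , y' , z') =
  Σ (Fin 3 ↔ Fin 3) λ π → ∀ i j →
    adj (triple x y z i) (triple x y z j)
      ≡ adj (triple x' y' z' (Inverse.to π i)) (triple x' y' z' (Inverse.to π j))

ThreeIsoregular : ∀ {N : ℕ} → Adjacency N → Fin N → Fin N → Set
ThreeIsoregular adj x y =
  x ≢ y ×
  (∀ z z' → z ≢ x → z ≢ y → z' ≢ x → z' ≢ y →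
     InducedIso₃ adj (x , y , z) (x , y , z') →
     valency₃ adj x y z ≡ valency₃ adj x y z')

LocallyThreeIsoregular : ∀ {N : ℕ} → Adjacency N → Fin N → Set
LocallyThreeIsoregular adj x =
  Σ _ λ y → Σ _ λ z →
    adj x y ≡ true × z ≢ x × adj x z ≡ false ×
    ThreeIsoregular adj x y × ThreeIsoregular adj x z

{-# OPTIONS --safe #-}
-- For a 3-isoregular pair (x, y), the valency of {x, y, v} with v ∉ {x, y} depends only on how
-- many of x, y are adjacent to v, so it takes three values val₀, val₁, val₂ on three classes of
-- vertices. Double counting common neighbours in the strongly regular graph expresses the sums of
-- this valency, of its product with that number, and of its square through the parameters, which
-- gives Diophantine equations in the class sizes and valencies. For odd m those of a non-adjacent
-- pair have no solution: they force the odd number m + 2 to divide 2 (j + 1) with 0 < j + 1 ≤ m.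
-- For even m the first-moment equations of an adjacent pair determine all class data, and the
-- second-moment equation then fails. A vertex at which Γ is locally 3-isoregular has both kinds
-- of pairs.
module Submission where

open import Defs
open import Data.Nat using (ℕ; _+_; _*_; _∸_; _≥_)
open import Data.Fin using (Fin)
open import Relation.Nullary using (¬_)

open import Algebra.Properties.CommutativeSemigroup using (x∙yz≈y∙xz)
open import Data.Bool using (Bool; true; false; not; _∧_; if_then_else_)
open import Data.Bool.Properties using (∧-assoc; ∧-idem; ∧-identityʳ)
open import Data.Empty using (⊥; ⊥-elim)
import Data.Fin.Permutation as Permutation
open import Data.Fin.Patterns using (0F; 1F; 2F)
open import Data.Fin.Properties using (_≟_; any?)
open import Data.List using (_∷_; []; tabulate)
open import Data.List.Properties using (map-tabulate)
open import Data.Nat using (zero; suc; _≤_; _<_; z≤n; s≤s; _≡ᵇ_)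
open import Data.Nat.Coprimality using (Coprime; coprime-divisor)
open import Data.Nat.Divisibility using (_∣_; divides; ∣m+n∣m⇒∣n; ∣1⇒≡1; ∣-trans; m∣m*n; ∣⇒≤; >⇒∤)
import Data.Nat.ListAction as List
open import Data.Nat.Properties
  using ( +-*-semiring; *-commutativeSemigroup; +-assoc; +-comm; +-suc; +-identityʳ; *-comm
        ; *-identityˡ; *-identityʳ; *-distribˡ-+; *-distribʳ-+; +-cancelʳ-≡; *-cancelˡ-≡; *-cancelˡ-≤
        ; *-cancelˡ-<; suc-injective; ≤-trans; <⇒≱; m≤n+m; n≤1+n; m≤n⇒m≤1+n; m+1+n≢m )
  renaming (_≟_ to _≟ℕ_)
open import Data.Nat.Tactic.RingSolver using (solve)
open import Data.Product using (∃; _×_; _,_; proj₁; proj₂)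
open import Data.Sum using (_⊎_; inj₁; inj₂)
open import Function using (_∘_; _∋_)
open import Relation.Binary.PropositionalEquality
  using (_≡_; _≢_; refl; sym; trans; cong; cong₂; subst; subst₂; module ≡-Reasoning)
open import Relation.Nullary using (Dec; does; yes; no; ¬?; _×-dec_)
open import Algebra.Properties.Semiring.Sum +-*-semiring
  using (sum; sum-syntax; sum-cong-≗; sum-replicate-zero; ∑-distrib-+; ∑-comm; *-distribˡ-sum; *-distribʳ-sum)

open ≡-Reasoning

cong₃ : ∀ {A B C D : Set} (f : A → B → C → D) {x x′ y y′ z z′} →
        x ≡ x′ → y ≡ y′ → z ≡ z′ → f x y z ≡ f x′ y′ z′
cong₃ f refl refl refl = refl

χ : Bool → ℕ
χ b = if b then 1 else 0

χ-∧ : ∀ a b → χ (a ∧ b) ≡ χ a * χ b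
χ-∧ true  b = sym (+-identityʳ (χ b))
χ-∧ false b = refl

χ-∧∧ : ∀ a b c → χ (a ∧ b ∧ c) ≡ χ (a ∧ b) * χ c
χ-∧∧ a b c = trans (cong χ (sym (∧-assoc a b c))) (χ-∧ (a ∧ b) c)

χ*-cong : ∀ b {a a′} → (b ≡ true → a ≡ a′) → χ b * a ≡ χ b * a′
χ*-cong true  a≡a′ = cong (_+ 0) (a≡a′ refl)
χ*-cong false a≡a′ = refl

χ+χ≡χ+χ⇒same⊎swapped : ∀ a b c d → χ a + χ b ≡ χ c + χ d → (a ≡ c × b ≡ d) ⊎ (a ≡ d × b ≡ c)
χ+χ≡χ+χ⇒same⊎swapped true  true  true  true  _  = inj₁ (refl , refl)
χ+χ≡χ+χ⇒same⊎swapped true  false true  false _  = inj₁ (refl , refl)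
χ+χ≡χ+χ⇒same⊎swapped false true  false true  _  = inj₁ (refl , refl)
χ+χ≡χ+χ⇒same⊎swapped false false false false _  = inj₁ (refl , refl)
χ+χ≡χ+χ⇒same⊎swapped true  false false true  _  = inj₂ (refl , refl)
χ+χ≡χ+χ⇒same⊎swapped false true  true  false _  = inj₂ (refl , refl)
χ+χ≡χ+χ⇒same⊎swapped true  true  true  false ()
χ+χ≡χ+χ⇒same⊎swapped true  true  false true  ()
χ+χ≡χ+χ⇒same⊎swapped true  true  false false ()
χ+χ≡χ+χ⇒same⊎swapped true  false true  true  ()
χ+χ≡χ+χ⇒same⊎swapped true  false false false ()
χ+χ≡χ+χ⇒same⊎swapped false true  true  true  ()
χ+χ≡χ+χ⇒same⊎swapped false true  false false ()
χ+χ≡χ+χ⇒same⊎swapped false false true  true  ()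
χ+χ≡χ+χ⇒same⊎swapped false false true  false ()
χ+χ≡χ+χ⇒same⊎swapped false false false true  ()

χ[χ+χ≡ᵇ2] : ∀ a b → χ (χ a + χ b ≡ᵇ 2) ≡ χ (a ∧ b)
χ[χ+χ≡ᵇ2] true  true  = refl
χ[χ+χ≡ᵇ2] true  false = refl
χ[χ+χ≡ᵇ2] false true  = refl
χ[χ+χ≡ᵇ2] false false = refl

χ-by-class : ∀ a b (g : ℕ → ℕ) →
  g (χ a + χ b) ≡ χ (χ a + χ b ≡ᵇ 0) * g 0 + χ (χ a + χ b ≡ᵇ 1) * g 1 + χ (χ a + χ b ≡ᵇ 2) * g 2
χ-by-class true  true  g = sym (+-identityʳ (g 2))
χ-by-class true  false g = sym (trans (+-identityʳ (g 1 + 0)) (+-identityʳ (g 1)))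
χ-by-class false true  g = sym (trans (+-identityʳ (g 1 + 0)) (+-identityʳ (g 1)))
χ-by-class false false g = sym (trans (+-identityʳ (g 0 + 0 + 0)) (trans (+-identityʳ (g 0 + 0)) (+-identityʳ (g 0))))

∧-trueˡ : ∀ a {b} → (a ∧ b) ≡ true → a ≡ true
∧-trueˡ true  _ = refl

∧-trueʳ : ∀ a {b} → (a ∧ b) ≡ true → b ≡ true
∧-trueʳ true  a∧b = a∧b

list-sum-tabulate : ∀ {n} (f : Fin n → ℕ) → List.sum (tabulate f) ≡ sum f
list-sum-tabulate {zero}  f = refl
list-sum-tabulate {suc n} f = cong (f Fin.zero +_) (list-sum-tabulate (f ∘ Fin.suc))

count≡∑χ : ∀ {N} (p : Fin N → Bool) → count p ≡ ∑[ v < N ] χ (p v)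
count≡∑χ {N} p = trans (cong List.sum (map-tabulate (λ v → v) (χ ∘ p))) (list-sum-tabulate (χ ∘ p))

count-cong : ∀ {N} {p q : Fin N → Bool} → (∀ v → p v ≡ q v) → count p ≡ count q
count-cong {p = p} {q} p≗q = trans (count≡∑χ p) (trans (sum-cong-≗ (cong χ ∘ p≗q)) (sym (count≡∑χ q)))

∑-one : ∀ n → ∑[ i < n ] 1 ≡ n
∑-one zero    = refl
∑-one (suc n) = cong suc (∑-one n)

∑-δ : ∀ {n} (w : Fin n) (f : Fin n → ℕ) → ∑[ v < n ] (χ (does (v ≟ w)) * f v) ≡ f w
∑-δ {suc n} Fin.zero    f = trans (cong₂ _+_ (+-identityʳ (f Fin.zero)) (sum-replicate-zero n)) (+-identityʳ (f Fin.zero))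
∑-δ {suc n} (Fin.suc w) f = ∑-δ w (f ∘ Fin.suc)

∑-χ*const : ∀ {n} (p : Fin n → Bool) a → ∑[ v < n ] (χ (p v) * a) ≡ count p * a
∑-χ*const p a = trans (sym (*-distribʳ-sum a (χ ∘ p))) (cong (_* a) (sym (count≡∑χ p)))

∑-linear-χ : ∀ {n} (p q r : Fin n → Bool) a b c →
  ∑[ v < n ] (χ (p v) * a + χ (q v) * b + χ (r v) * c) ≡ count p * a + count q * b + count r * c
∑-linear-χ p q r a b c = begin
  ∑[ v < _ ] (χ (p v) * a + χ (q v) * b + χ (r v) * c)
    ≡⟨ ∑-distrib-+ (λ v → χ (p v) * a + χ (q v) * b) (λ v → χ (r v) * c) ⟩
  ∑[ v < _ ] (χ (p v) * a + χ (q v) * b) + ∑[ v < _ ] (χ (r v) * c)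
    ≡⟨ cong (_+ ∑[ v < _ ] (χ (r v) * c)) (∑-distrib-+ (λ v → χ (p v) * a) (λ v → χ (q v) * b)) ⟩
  ∑[ v < _ ] (χ (p v) * a) + ∑[ v < _ ] (χ (q v) * b) + ∑[ v < _ ] (χ (r v) * c)
    ≡⟨ cong₂ _+_ (cong₂ _+_ (∑-χ*const p a) (∑-χ*const q b)) (∑-χ*const r c) ⟩
  count p * a + count q * b + count r * c ∎

∑-linear₃ : ∀ {n} a b c (f g h : Fin n → ℕ) →
  ∑[ v < n ] (a * f v + b * g v + c * h v) ≡ a * sum f + b * sum g + c * sum h
∑-linear₃ a b c f g h = begin
  ∑[ v < _ ] (a * f v + b * g v + c * h v)
    ≡⟨ ∑-distrib-+ (λ v → a * f v + b * g v) (λ v → c * h v) ⟩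
  ∑[ v < _ ] (a * f v + b * g v) + ∑[ v < _ ] (c * h v)
    ≡⟨ cong (_+ ∑[ v < _ ] (c * h v)) (∑-distrib-+ (λ v → a * f v) (λ v → b * g v)) ⟩
  ∑[ v < _ ] (a * f v) + ∑[ v < _ ] (b * g v) + ∑[ v < _ ] (c * h v)
    ≡⟨ sym (cong₂ _+_ (cong₂ _+_ (*-distribˡ-sum a f) (*-distribˡ-sum b g)) (*-distribˡ-sum c h)) ⟩
  a * sum f + b * sum g + c * sum h ∎

module DoubleCounting {N} {A : Adjacency N} (graph : IsGraph A) {k l μ : ℕ} (srg : IsSRG A k l μ) where
  open IsGraph graph
  open IsSRG srg

  ∑-adjacent : ∀ u → ∑[ v < N ] χ (A u v) ≡ k
  ∑-adjacent u = trans (sym (count≡∑χ (A u))) (regular u)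

  common₂≡∑ : ∀ u w → common₂ A u w ≡ ∑[ v < N ] (χ (A u v) * χ (A w v))
  common₂≡∑ u w = trans (count≡∑χ (λ v → A u v ∧ A w v)) (sum-cong-≗ (λ v → χ-∧ (A u v) (A w v)))

  -- Double counting of the pairs (w, v) with w a common neighbour of x, y and v ~ w.
  ∑-weighted-valency₃ : ∀ x y (h : Fin N → ℕ) →
    ∑[ v < N ] (h v * valency₃ A x y v)
      ≡ ∑[ w < N ] (χ (A x w ∧ A y w) * ∑[ v < N ] (h v * χ (A w v)))
  ∑-weighted-valency₃ x y h = begin
    ∑[ v < N ] (h v * valency₃ A x y v)
      ≡⟨ sum-cong-≗ (λ v → trans (cong (h v *_) (count≡∑χ (λ w → A x w ∧ A y w ∧ A v w)))
                                 (*-distribˡ-sum (h v) (λ w → χ (A x w ∧ A y w ∧ A v w)))) ⟩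
    ∑[ v < N ] ∑[ w < N ] (h v * χ (A x w ∧ A y w ∧ A v w))
      ≡⟨ sum-cong-≗ (λ v → sum-cong-≗ (λ w → regroup v w)) ⟩
    ∑[ v < N ] ∑[ w < N ] (χ (A x w ∧ A y w) * (h v * χ (A w v)))
      ≡⟨ ∑-comm (λ v w → χ (A x w ∧ A y w) * (h v * χ (A w v))) ⟩
    ∑[ w < N ] ∑[ v < N ] (χ (A x w ∧ A y w) * (h v * χ (A w v)))
      ≡⟨ sum-cong-≗ (λ w → sym (*-distribˡ-sum (χ (A x w ∧ A y w)) (λ v → h v * χ (A w v)))) ⟩
    ∑[ w < N ] (χ (A x w ∧ A y w) * ∑[ v < N ] (h v * χ (A w v))) ∎
    where
    regroup : ∀ v w → h v * χ (A x w ∧ A y w ∧ A v w) ≡ χ (A x w ∧ A y w) * (h v * χ (A w v))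
    regroup v w = begin
      h v * χ (A x w ∧ A y w ∧ A v w)     ≡⟨ cong (h v *_) (χ-∧∧ (A x w) (A y w) (A v w)) ⟩
      h v * (χ (A x w ∧ A y w) * χ (A v w)) ≡⟨ x∙yz≈y∙xz *-commutativeSemigroup (h v) (χ (A x w ∧ A y w)) (χ (A v w)) ⟩
      χ (A x w ∧ A y w) * (h v * χ (A v w)) ≡⟨ cong (λ b → χ (A x w ∧ A y w) * (h v * χ b)) (symmetric v w) ⟩
      χ (A x w ∧ A y w) * (h v * χ (A w v)) ∎

  ∑-valency₃ : ∀ x y → ∑[ v < N ] valency₃ A x y v ≡ k * common₂ A x y
  ∑-valency₃ x y = begin
    ∑[ v < N ] valency₃ A x y v            ≡⟨ sum-cong-≗ (λ v → sym (*-identityˡ (valency₃ A x y v))) ⟩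
    ∑[ v < N ] (1 * valency₃ A x y v)      ≡⟨ ∑-weighted-valency₃ x y (λ _ → 1) ⟩
    ∑[ w < N ] (χ (A x w ∧ A y w) * ∑[ v < N ] (1 * χ (A w v)))
      ≡⟨ sum-cong-≗ (λ w → cong (χ (A x w ∧ A y w) *_)
                                (trans (sum-cong-≗ (λ v → *-identityˡ (χ (A w v)))) (∑-adjacent w))) ⟩
    ∑[ w < N ] (χ (A x w ∧ A y w) * k)     ≡⟨ ∑-χ*const (λ w → A x w ∧ A y w) k ⟩
    common₂ A x y * k                       ≡⟨ *-comm (common₂ A x y) k ⟩
    k * common₂ A x y                       ∎

  ∑-adjacent-valency₃ : ∀ x y u → (∀ w → (A x w ∧ A y w) ≡ true → A u w ≡ true) →
    ∑[ v < N ] (χ (A u v) * valency₃ A x y v) ≡ l * common₂ A x y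
  ∑-adjacent-valency₃ x y u u~common = begin
    ∑[ v < N ] (χ (A u v) * valency₃ A x y v)  ≡⟨ ∑-weighted-valency₃ x y (χ ∘ A u) ⟩
    ∑[ w < N ] (χ (A x w ∧ A y w) * ∑[ v < N ] (χ (A u v) * χ (A w v)))
      ≡⟨ sum-cong-≗ (λ w → χ*-cong (A x w ∧ A y w)
                                   (λ w∈T → trans (sym (common₂≡∑ u w)) (adjacentλ u w (u~common w w∈T)))) ⟩
    ∑[ w < N ] (χ (A x w ∧ A y w) * l)         ≡⟨ ∑-χ*const (λ w → A x w ∧ A y w) l ⟩
    common₂ A x y * l                           ≡⟨ *-comm (common₂ A x y) l ⟩
    l * common₂ A x y                           ∎

  valency₃≡∑ : ∀ x y w → valency₃ A x y w ≡ ∑[ w′ < N ] (χ (A x w′ ∧ A y w′) * χ (A w w′))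
  valency₃≡∑ x y w = trans (count≡∑χ (λ w′ → A x w′ ∧ A y w′ ∧ A w w′))
                           (sum-cong-≗ (λ w′ → χ-∧∧ (A x w′) (A y w′) (A w w′)))

  common₂-self : ∀ w → common₂ A w w ≡ k
  common₂-self w = trans (count-cong (λ v → ∧-idem (A w v))) (regular w)

  -- The three cases of the strong regularity condition in one identity.
  common₂-by-adjacency : ∀ w w′ →
    common₂ A w w′ + μ * (χ (does (w′ ≟ w)) + χ (A w w′)) ≡ k * χ (does (w′ ≟ w)) + l * χ (A w w′) + μ
  common₂-by-adjacency w w′ with w′ ≟ w
  ... | yes refl rewrite irreflexive w′ | common₂-self w′ = solve (k ∷ l ∷ μ ∷ [])
  ... | no w′≢w with A w w′ in w~w′
  ...   | true  rewrite adjacentλ w w′ w~w′ = solve (k ∷ l ∷ μ ∷ [])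
  ...   | false rewrite nonadjμ w w′ (w′≢w ∘ sym) w~w′ = solve (k ∷ l ∷ μ ∷ [])

  ∑-common₂-from-common-neighbour : ∀ x y w → (A x w ∧ A y w) ≡ true →
    ∑[ w′ < N ] (χ (A x w′ ∧ A y w′) * common₂ A w w′) + μ * (1 + valency₃ A x y w)
      ≡ k + l * valency₃ A x y w + μ * common₂ A x y
  ∑-common₂-from-common-neighbour x y w w∈T = begin
    sum F + μ * (1 + valency₃ A x y w)
      ≡⟨ cong₂ _+_ (sym (*-identityˡ (sum F))) (*-distribˡ-+ μ 1 (valency₃ A x y w)) ⟩
    1 * sum F + (μ * 1 + μ * valency₃ A x y w)
      ≡⟨ sym (+-assoc (1 * sum F) (μ * 1) _) ⟩
    1 * sum F + μ * 1 + μ * valency₃ A x y w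
      ≡⟨ cong₂ (λ a b → 1 * sum F + μ * a + μ * b) (sym ∑G≡1) (valency₃≡∑ x y w) ⟩
    1 * sum F + μ * sum G + μ * sum H
      ≡⟨ sym (∑-linear₃ 1 μ μ F G H) ⟩
    ∑[ w′ < N ] (1 * F w′ + μ * G w′ + μ * H w′)
      ≡⟨ sum-cong-≗ (λ w′ → scale (t w′) (common₂ A w w′) _ _ (common₂-by-adjacency w w′)) ⟩
    ∑[ w′ < N ] (k * G w′ + l * H w′ + μ * t w′)
      ≡⟨ ∑-linear₃ k l μ G H t ⟩
    k * sum G + l * sum H + μ * sum t
      ≡⟨ cong₂ (λ a b → k * a + l * sum H + μ * b) ∑G≡1 (sym (count≡∑χ (λ w′ → A x w′ ∧ A y w′))) ⟩
    k * 1 + l * sum H + μ * common₂ A x y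
      ≡⟨ cong₂ (λ a b → a + l * b + μ * common₂ A x y) (*-identityʳ k) (sym (valency₃≡∑ x y w)) ⟩
    k + l * valency₃ A x y w + μ * common₂ A x y ∎
    where
    t F G H : Fin N → ℕ
    t w′ = χ (A x w′ ∧ A y w′)
    F w′ = t w′ * common₂ A w w′
    G w′ = χ (does (w′ ≟ w)) * t w′
    H w′ = t w′ * χ (A w w′)
    ∑G≡1 : sum G ≡ 1
    ∑G≡1 = trans (∑-δ w t) (cong χ w∈T)
    scale : ∀ s c δ e → c + μ * (δ + e) ≡ k * δ + l * e + μ →
      1 * (s * c) + μ * (δ * s) + μ * (s * e) ≡ k * (δ * s) + l * (s * e) + μ * s
    scale s c δ e eq = begin
      1 * (s * c) + μ * (δ * s) + μ * (s * e) ≡⟨ solve (s ∷ c ∷ δ ∷ e ∷ μ ∷ []) ⟩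
      s * (c + μ * (δ + e))                   ≡⟨ cong (s *_) eq ⟩
      s * (k * δ + l * e + μ)                 ≡⟨ solve (s ∷ δ ∷ e ∷ k ∷ l ∷ μ ∷ []) ⟩
      k * (δ * s) + l * (s * e) + μ * s       ∎

  ∑-valency₃² : ∀ x y →
    ∑[ v < N ] (valency₃ A x y v * valency₃ A x y v) + μ * ∑[ v < N ] (χ (A x v ∧ A y v) * (1 + valency₃ A x y v))
      ≡ ∑[ v < N ] (χ (A x v ∧ A y v) * (k + l * valency₃ A x y v + μ * common₂ A x y))
  ∑-valency₃² x y = begin
    ∑[ v < N ] (V v * V v) + μ * ∑[ v < N ] (t v * (1 + V v))
      ≡⟨ cong (_+ μ * ∑[ v < N ] (t v * (1 + V v))) squares ⟩
    ∑[ w < N ] (t w * J w) + μ * ∑[ v < N ] (t v * (1 + V v))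
      ≡⟨ cong (∑[ w < N ] (t w * J w) +_) (*-distribˡ-sum μ (λ v → t v * (1 + V v))) ⟩
    ∑[ w < N ] (t w * J w) + ∑[ v < N ] (μ * (t v * (1 + V v)))
      ≡⟨ sym (∑-distrib-+ (λ w → t w * J w) (λ v → μ * (t v * (1 + V v)))) ⟩
    ∑[ v < N ] (t v * J v + μ * (t v * (1 + V v)))
      ≡⟨ sum-cong-≗ (λ v → trans (factor (t v) (J v) (1 + V v))
                                 (χ*-cong (A x v ∧ A y v) (∑-common₂-from-common-neighbour x y v))) ⟩
    ∑[ v < N ] (t v * (k + l * V v + μ * common₂ A x y)) ∎
    where
    t V J : Fin N → ℕ
    t v = χ (A x v ∧ A y v)
    V = valency₃ A x y
    J w = ∑[ w′ < N ] (t w′ * common₂ A w w′)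
    squares : ∑[ v < N ] (V v * V v) ≡ ∑[ w < N ] (t w * J w)
    squares = trans (∑-weighted-valency₃ x y V) (sum-cong-≗ (λ w → cong (t w *_) (begin
      ∑[ v < N ] (V v * χ (A w v))          ≡⟨ sum-cong-≗ (λ v → *-comm (V v) (χ (A w v))) ⟩
      ∑[ v < N ] (χ (A w v) * V v)          ≡⟨ ∑-weighted-valency₃ x y (χ ∘ A w) ⟩
      ∑[ w′ < N ] (t w′ * ∑[ v < N ] (χ (A w v) * χ (A w′ v)))
        ≡⟨ sum-cong-≗ (λ w′ → cong (t w′ *_) (sym (common₂≡∑ w w′))) ⟩
      J w ∎)))
    factor : ∀ s a b → s * a + μ * (s * b) ≡ s * (a + μ * b)
    factor s a b = solve (s ∷ a ∷ b ∷ μ ∷ [])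

module Classes {N} {A : Adjacency N} (graph : IsGraph A) (x y : Fin N) (x≢y : x ≢ y) where
  open IsGraph graph

  adjCount : Fin N → ℕ
  adjCount v = χ (A x v) + χ (A y v)

  outside : Fin N → Bool
  outside v = not (does (v ≟ x)) ∧ not (does (v ≟ y))

  classSize : ℕ → ℕ
  classSize i = count (λ v → outside v ∧ (adjCount v ≡ᵇ i))

  χ-partition : ∀ v → χ (does (v ≟ x)) + χ (does (v ≟ y)) + χ (outside v) ≡ 1
  χ-partition v with v ≟ x | v ≟ y
  ... | yes refl | yes v≡y = ⊥-elim (x≢y v≡y)
  ... | yes _    | no _    = refl
  ... | no _     | yes _   = refl
  ... | no _     | no _    = refl

  ∑-split : ∀ (F : Fin N → ℕ) → sum F ≡ F x + F y + ∑[ v < N ] (χ (outside v) * F v)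
  ∑-split F = begin
    sum F                          ≡⟨ sum-cong-≗ (sym ∘ weighted) ⟩
    ∑[ v < N ] (X v + Y v + O v)   ≡⟨ ∑-distrib-+ (λ v → X v + Y v) O ⟩
    ∑[ v < N ] (X v + Y v) + sum O ≡⟨ cong (_+ sum O) (∑-distrib-+ X Y) ⟩
    sum X + sum Y + sum O          ≡⟨ cong₂ (λ a b → a + b + sum O) (∑-δ x F) (∑-δ y F) ⟩
    F x + F y + sum O              ∎
    where
    X Y O : Fin N → ℕ
    X v = χ (does (v ≟ x)) * F v
    Y v = χ (does (v ≟ y)) * F v
    O v = χ (outside v) * F v
    weighted : ∀ v → X v + Y v + O v ≡ F v
    weighted v = begin
      X v + Y v + O v
        ≡⟨ cong (_+ O v) (sym (*-distribʳ-+ (F v) (χ (does (v ≟ x))) _)) ⟩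
      (χ (does (v ≟ x)) + χ (does (v ≟ y))) * F v + O v
        ≡⟨ sym (*-distribʳ-+ (F v) (χ (does (v ≟ x)) + χ (does (v ≟ y))) _) ⟩
      (χ (does (v ≟ x)) + χ (does (v ≟ y)) + χ (outside v)) * F v
        ≡⟨ cong (_* F v) (χ-partition v) ⟩
      1 * F v
        ≡⟨ *-identityˡ (F v) ⟩
      F v ∎

  outside⇒≢ : ∀ {v} → outside v ≡ true → v ≢ x × v ≢ y
  outside⇒≢ {v} out with v ≟ x | v ≟ y
  ... | no v≢x | no v≢y = v≢x , v≢y

  adjCount-x : adjCount x ≡ χ (A x y)
  adjCount-x rewrite irreflexive x | symmetric y x = refl

  adjCount-y : adjCount y ≡ χ (A x y)
  adjCount-y rewrite irreflexive y = +-identityʳ (χ (A x y))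

  valency₃-x : valency₃ A x y x ≡ common₂ A x y
  valency₃-x = count-cong (λ w → absorb (A x w) (A y w))
    where
    absorb : ∀ a b → (a ∧ b ∧ a) ≡ (a ∧ b)
    absorb true  b = ∧-identityʳ b
    absorb false b = refl

  valency₃-y : valency₃ A x y y ≡ common₂ A x y
  valency₃-y = count-cong (λ w → cong (A x w ∧_) (∧-idem (A y w)))

  ∑-by-class : (val : ℕ → ℕ) → (∀ v → v ≢ x → v ≢ y → valency₃ A x y v ≡ val (adjCount v)) →
    ∀ (G : ℕ → ℕ → ℕ) →
    ∑[ v < N ] G (adjCount v) (valency₃ A x y v)
      ≡ 2 * G (χ (A x y)) (common₂ A x y)
        + classSize 0 * G 0 (val 0) + classSize 1 * G 1 (val 1) + classSize 2 * G 2 (val 2)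
  ∑-by-class val val-spec G = begin
    sum F
      ≡⟨ ∑-split F ⟩
    F x + F y + ∑[ v < N ] (χ (outside v) * F v)
      ≡⟨ cong₂ _+_ (cong₂ _+_ (cong₂ G adjCount-x valency₃-x) (cong₂ G adjCount-y valency₃-y))
                   (sum-cong-≗ by-class) ⟩
    G₀ + G₀ + ∑[ v < N ] (χ (class 0 v) * g 0 + χ (class 1 v) * g 1 + χ (class 2 v) * g 2)
      ≡⟨ cong (G₀ + G₀ +_) (∑-linear-χ (class 0) (class 1) (class 2) (g 0) (g 1) (g 2)) ⟩
    G₀ + G₀ + (classSize 0 * g 0 + classSize 1 * g 1 + classSize 2 * g 2)
      ≡⟨ double G₀ (classSize 0 * g 0) (classSize 1 * g 1) (classSize 2 * g 2) ⟩
    2 * G₀ + classSize 0 * g 0 + classSize 1 * g 1 + classSize 2 * g 2 ∎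
    where
    F : Fin N → ℕ
    F v = G (adjCount v) (valency₃ A x y v)
    G₀ : ℕ
    G₀ = G (χ (A x y)) (common₂ A x y)
    g : ℕ → ℕ
    g i = G i (val i)
    class : ℕ → Fin N → Bool
    class i v = outside v ∧ (adjCount v ≡ᵇ i)
    by-class : ∀ v → χ (outside v) * F v ≡ χ (class 0 v) * g 0 + χ (class 1 v) * g 1 + χ (class 2 v) * g 2
    by-class v with outside v in out
    ... | false = refl
    ... | true  rewrite val-spec v (proj₁ (outside⇒≢ out)) (proj₂ (outside⇒≢ out)) =
      trans (+-identityʳ (g (adjCount v))) (χ-by-class (A x v) (A y v) g)
    double : ∀ a b c d → a + a + (b + c + d) ≡ 2 * a + b + c + d
    double a b c d = solve (a ∷ b ∷ c ∷ d ∷ [])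

  induced-iso-fixing : ∀ {z z′} → A x z ≡ A x z′ → A y z ≡ A y z′ → InducedIso₃ A (x , y , z) (x , y , z′)
  induced-iso-fixing {z} {z′} x≈ y≈ = Permutation.id , edges
    where
    edges : ∀ i j → _
    edges 0F 0F = refl
    edges 0F 1F = refl
    edges 0F 2F = x≈
    edges 1F 0F = refl
    edges 1F 1F = refl
    edges 1F 2F = y≈
    edges 2F 0F = trans (symmetric z x) (trans x≈ (symmetric x z′))
    edges 2F 1F = trans (symmetric z y) (trans y≈ (symmetric y z′))
    edges 2F 2F = trans (irreflexive z) (sym (irreflexive z′))

  induced-iso-swapping : ∀ {z z′} → A x z ≡ A y z′ → A y z ≡ A x z′ → InducedIso₃ A (x , y , z) (x , y , z′)
  induced-iso-swapping {z} {z′} x≈ y≈ = Permutation.transpose 0F 1F , edges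
    where
    edges : ∀ i j → _
    edges 0F 0F = trans (irreflexive x) (sym (irreflexive y))
    edges 0F 1F = symmetric x y
    edges 0F 2F = x≈
    edges 1F 0F = symmetric y x
    edges 1F 1F = trans (irreflexive y) (sym (irreflexive x))
    edges 1F 2F = y≈
    edges 2F 0F = trans (symmetric z x) (trans x≈ (symmetric y z′))
    edges 2F 1F = trans (symmetric z y) (trans y≈ (symmetric x z′))
    edges 2F 2F = trans (irreflexive z) (sym (irreflexive z′))

  induced-iso : ∀ {z z′} → adjCount z ≡ adjCount z′ → InducedIso₃ A (x , y , z) (x , y , z′)
  induced-iso {z} {z′} same with χ+χ≡χ+χ⇒same⊎swapped (A x z) (A y z) (A x z′) (A y z′) same
  ... | inj₁ (x≈ , y≈) = induced-iso-fixing x≈ y≈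
  ... | inj₂ (x≈ , y≈) = induced-iso-swapping x≈ y≈

  valency₃-via-adjCount : ThreeIsoregular A x y →
    ∃ λ (val : ℕ → ℕ) → ∀ v → v ≢ x → v ≢ y → valency₃ A x y v ≡ val (adjCount v)
  valency₃-via-adjCount (_ , isoregular) = (λ i → valency-of (representative i)) , spec
    where
    Representative : ℕ → Set
    Representative i = ∃ λ t → t ≢ x × t ≢ y × adjCount t ≡ i
    representative : ∀ i → Dec (Representative i)
    representative i = any? (λ t → ¬? (t ≟ x) ×-dec ¬? (t ≟ y) ×-dec adjCount t ≟ℕ i)
    valency-of : ∀ {i} → Dec (Representative i) → ℕ
    valency-of (yes (t , _)) = valency₃ A x y t
    valency-of (no _)        = 0
    spec : ∀ v → v ≢ x → v ≢ y → valency₃ A x y v ≡ valency-of (representative (adjCount v))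
    spec v v≢x v≢y with representative (adjCount v)
    ... | yes (t , t≢x , t≢y , same) = isoregular v t v≢x v≢y t≢x t≢y (induced-iso (sym same))
    ... | no none = ⊥-elim (none (v , v≢x , v≢y , refl))

-- The class data of a 3-isoregular pair (x, y), with δ = χ (x ~ y) and c its number of common
-- neighbours: nᵢ vertices v ∉ {x, y} are adjacent to exactly i of x, y, and valency₃ x y v = valᵢ
-- for them. classTotal G stands for ∑ over all v of G (adjCount v) (valency₃ x y v), to which x
-- and y contribute G δ c each.
record ValencyCounts (N k l μ δ c : ℕ) : Set where
  field
    n₀ n₁ n₂ val₀ val₁ val₂ : ℕ

  classTotal : (ℕ → ℕ → ℕ) → ℕ
  classTotal G = 2 * G δ c + n₀ * G 0 val₀ + n₁ * G 1 val₁ + n₂ * G 2 val₂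

  field
    order      : classTotal (λ _ _ → 1) ≡ N
    degrees    : classTotal (λ a _ → a) ≡ k + k
    common     : classTotal (λ a _ → χ (a ≡ᵇ 2)) ≡ c
    moment₁    : classTotal (λ _ t → t) ≡ k * c
    adj-moment : classTotal (λ a t → a * t) ≡ l * c + l * c
    moment₂    : classTotal (λ _ t → t * t) + μ * classTotal (λ a t → χ (a ≡ᵇ 2) * (1 + t))
                   ≡ classTotal (λ a t → χ (a ≡ᵇ 2) * (k + l * t + μ * c))

ValencyCountsₘ : ℕ → ℕ → ℕ → Set
ValencyCountsₘ m δ c =
  ValencyCounts ((2 * m * m + 2 * m + 1) + (2 * m * m + 2 * m + 1)) (m * (2 * m + 1)) (m * m ∸ 1) (m * m) δ c

valencyCounts : ∀ {N} {A : Adjacency N} → IsGraph A → ∀ {k l μ} → IsSRG A k l μ →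
  ∀ {x y} → ThreeIsoregular A x y → ValencyCounts N k l μ (χ (A x y)) (common₂ A x y)
valencyCounts {N} {A} graph {k} {l} {μ} srg {x} {y} isoregular@(x≢y , _) = record
  { n₀ = classSize 0 ; n₁ = classSize 1 ; n₂ = classSize 2
  ; val₀ = val 0 ; val₁ = val 1 ; val₂ = val 2
  ; order      = by-class (λ _ _ → 1) (∑-one N)
  ; degrees    = by-class (λ a _ → a)
                   (trans (∑-distrib-+ (χ ∘ A x) (χ ∘ A y)) (cong₂ _+_ (∑-adjacent x) (∑-adjacent y)))
  ; common     = by-class (λ a _ → χ (a ≡ᵇ 2))
                   (trans (sum-cong-≗ both) (sym (count≡∑χ (λ v → A x v ∧ A y v))))
  ; moment₁    = by-class (λ _ t → t) (∑-valency₃ x y)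
  ; adj-moment = by-class (λ a t → a * t) ∑-adjCount-valency₃
  ; moment₂    = trans (cong₂ (λ a b → a + μ * b) (by-class (λ _ t → t * t) refl)
                                                 (by-class (λ a t → χ (a ≡ᵇ 2) * (1 + t)) (on-common (1 +_))))
                       (trans (∑-valency₃² x y)
                              (sym (by-class (λ a t → χ (a ≡ᵇ 2) * (k + l * t + μ * common₂ A x y))
                                             (on-common (λ t → k + l * t + μ * common₂ A x y)))))
  }
  where
  open DoubleCounting graph srg
  open Classes graph x y x≢y
  val : ℕ → ℕ
  val = proj₁ (valency₃-via-adjCount isoregular)
  by-class : ∀ G {s} → ∑[ v < N ] G (adjCount v) (valency₃ A x y v) ≡ s →
    2 * G (χ (A x y)) (common₂ A x y)
      + classSize 0 * G 0 (val 0) + classSize 1 * G 1 (val 1) + classSize 2 * G 2 (val 2) ≡ s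
  by-class G = trans (sym (∑-by-class val (proj₂ (valency₃-via-adjCount isoregular)) G))
  both : ∀ v → χ (adjCount v ≡ᵇ 2) ≡ χ (A x v ∧ A y v)
  both v = χ[χ+χ≡ᵇ2] (A x v) (A y v)
  on-common : (f : ℕ → ℕ) → ∑[ v < N ] (χ (adjCount v ≡ᵇ 2) * f (valency₃ A x y v))
                          ≡ ∑[ v < N ] (χ (A x v ∧ A y v) * f (valency₃ A x y v))
  on-common f = sum-cong-≗ (λ v → cong (_* f (valency₃ A x y v)) (both v))
  ∑-adjCount-valency₃ : ∑[ v < N ] (adjCount v * valency₃ A x y v) ≡ l * common₂ A x y + l * common₂ A x y
  ∑-adjCount-valency₃ = begin
    ∑[ v < N ] (adjCount v * valency₃ A x y v)
      ≡⟨ sum-cong-≗ (λ v → *-distribʳ-+ (valency₃ A x y v) (χ (A x v)) (χ (A y v))) ⟩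
    ∑[ v < N ] (χ (A x v) * valency₃ A x y v + χ (A y v) * valency₃ A x y v)
      ≡⟨ ∑-distrib-+ (λ v → χ (A x v) * valency₃ A x y v) (λ v → χ (A y v) * valency₃ A x y v) ⟩
    ∑[ v < N ] (χ (A x v) * valency₃ A x y v) + ∑[ v < N ] (χ (A y v) * valency₃ A x y v)
      ≡⟨ cong₂ _+_ (∑-adjacent-valency₃ x y x (λ w → ∧-trueˡ (A x w)))
                   (∑-adjacent-valency₃ x y y (λ w → ∧-trueʳ (A x w))) ⟩
    l * common₂ A x y + l * common₂ A x y ∎

coprime-suc : ∀ n → Coprime n (suc n)
coprime-suc n {d} (d∣n , d∣1+n) = ∣1⇒≡1 (∣m+n∣m⇒∣n (subst (d ∣_) (+-comm 1 n) d∣1+n) d∣n)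

coprime-odd-2 : ∀ t → Coprime (3 + (t + t)) 2
coprime-odd-2 t {d} (d∣odd , d∣2) =
  ∣1⇒≡1 (∣m+n∣m⇒∣n (subst (d ∣_) odd d∣odd) (∣-trans d∣2 (m∣m*n {2} (suc t))))
  where
  odd : 3 + (t + t) ≡ 2 * suc t + 1
  odd = solve (t ∷ [])

∣∧<⇒≡0 : ∀ {d} i → d ∣ i → i < d → i ≡ 0
∣∧<⇒≡0 zero    _   _   = refl
∣∧<⇒≡0 (suc i) d∣i i<d = ⊥-elim (>⇒∤ i<d d∣i)

-- Here m = suc n and d = 3 + n = m + 2 is odd; these are the first-moment equations of a
-- non-adjacent pair with common factors divided out. The first forces v₁ = j m with j < m, and
-- then the second forces d ∣ 2 (j + 1).
nonadjacent-system-unsolvable : ∀ n v₀ v₁ v₂ → Coprime (3 + n) 2 →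
  suc n * v₂ + (2 + n) * v₁ ≡ n * (n + 2) * suc n →
  (3 + n) * v₀ + (2 + n) * v₁ + 2 * suc n + n * (n + 2) * suc n ≡ suc n * (2 * suc n + 1) * suc n → ⊥
nonadjacent-system-unsolvable n v₀ v₁ v₂ d-odd e₁ e₂
  with suc n ∣ v₁ ∋ coprime-divisor (coprime-suc (suc n)) (∣m+n∣m⇒∣n (divides (n * (n + 2)) e₁) (m∣m*n v₂))
... | divides j refl = <⇒≱ (n≤1+n (2 + n)) (≤-trans (∣⇒≤ d∣1+j) (s≤s j≤n))
  where
  j≤n : j ≤ n
  j≤n = *-cancelˡ-≤ (2 + n) (subst ((2 + n) * j ≤_) (trans cancelled n*[n+2]≡[2+n]*n) (m≤n+m _ v₂))
    where
    n*[n+2]≡[2+n]*n : n * (n + 2) ≡ (2 + n) * n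
    n*[n+2]≡[2+n]*n = solve (n ∷ [])
    cancelled : v₂ + (2 + n) * j ≡ n * (n + 2)
    cancelled = *-cancelˡ-≡ _ _ (suc n) (begin
      suc n * (v₂ + (2 + n) * j)            ≡⟨ solve (n ∷ v₂ ∷ j ∷ []) ⟩
      suc n * v₂ + (2 + n) * (j * suc n)    ≡⟨ e₁ ⟩
      n * (n + 2) * suc n                   ≡⟨ solve (n ∷ []) ⟩
      suc n * (n * (n + 2))                 ∎)
  d∣1+j : 3 + n ∣ suc j
  d∣1+j = coprime-divisor d-odd
    (∣m+n∣m⇒∣n (divides (n * n + n + 1) (trans reduced (*-comm (3 + n) (n * n + n + 1)))) (m∣m*n (v₀ + n * j)))
    where
    reduced : (3 + n) * (v₀ + n * j) + 2 * suc j ≡ (3 + n) * (n * n + n + 1)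
    reduced = +-cancelʳ-≡ (2 * n + n * (n + 2) * suc n) _ _ (begin
      (3 + n) * (v₀ + n * j) + 2 * suc j + (2 * n + n * (n + 2) * suc n)
        ≡⟨ solve (n ∷ v₀ ∷ j ∷ []) ⟩
      (3 + n) * v₀ + (2 + n) * (j * suc n) + 2 * suc n + n * (n + 2) * suc n
        ≡⟨ e₂ ⟩
      suc n * (2 * suc n + 1) * suc n
        ≡⟨ solve (n ∷ []) ⟩
      (3 + n) * (n * n + n + 1) + (2 * n + n * (n + 2) * suc n) ∎)

¬ValencyCounts-nonadjacent : ∀ n → Coprime (3 + n) 2 → ¬ ValencyCountsₘ (suc n) 0 (suc n * suc n)
¬ValencyCounts-nonadjacent n d-odd record
  { n₀ = n₀ ; n₁ = n₁ ; n₂ = n₂ ; val₀ = v₀ ; val₁ = v₁ ; val₂ = v₂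
  ; order = order ; degrees = degrees ; common = common ; moment₁ = moment₁ ; adj-moment = adj-moment }
  = nonadjacent-system-unsolvable n v₀ v₁ v₂ d-odd reduced-adj-moment reduced-moment₁
  where
  n₂≡ : n₂ ≡ suc n * suc n
  n₂≡ = begin
    n₂                                         ≡⟨ solve (n₀ ∷ n₁ ∷ n₂ ∷ []) ⟩
    2 * 0 + n₀ * 0 + n₁ * 0 + n₂ * 1           ≡⟨ common ⟩
    suc n * suc n                              ∎
  n₁≡ : n₁ ≡ 2 * (suc n * (2 + n))
  n₁≡ = +-cancelʳ-≡ (2 * n₂) _ _ (begin
    n₁ + 2 * n₂                                ≡⟨ solve (n₀ ∷ n₁ ∷ n₂ ∷ []) ⟩
    2 * 0 + n₀ * 0 + n₁ * 1 + n₂ * 2           ≡⟨ degrees ⟩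
    suc n * (2 * suc n + 1) + suc n * (2 * suc n + 1)
                                               ≡⟨ solve (n ∷ []) ⟩
    2 * (suc n * (2 + n)) + 2 * (suc n * suc n) ≡⟨ cong (λ a → 2 * (suc n * (2 + n)) + 2 * a) (sym n₂≡) ⟩
    2 * (suc n * (2 + n)) + 2 * n₂             ∎)
  n₀≡ : n₀ ≡ suc n * (3 + n)
  n₀≡ = +-cancelʳ-≡ (2 + n₁ + n₂) _ _ (begin
    n₀ + (2 + n₁ + n₂)                         ≡⟨ solve (n₀ ∷ n₁ ∷ n₂ ∷ []) ⟩
    2 * 1 + n₀ * 1 + n₁ * 1 + n₂ * 1           ≡⟨ order ⟩
    (2 * suc n * suc n + 2 * suc n + 1) + (2 * suc n * suc n + 2 * suc n + 1)
                                               ≡⟨ solve (n ∷ []) ⟩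
    suc n * (3 + n) + (2 + 2 * (suc n * (2 + n)) + suc n * suc n)
                                               ≡⟨ cong₂ (λ a b → suc n * (3 + n) + (2 + a + b)) (sym n₁≡) (sym n₂≡) ⟩
    suc n * (3 + n) + (2 + n₁ + n₂)            ∎)
  reduced-adj-moment : suc n * v₂ + (2 + n) * v₁ ≡ n * (n + 2) * suc n
  reduced-adj-moment = *-cancelˡ-≡ _ _ (2 * suc n) (begin
    2 * suc n * (suc n * v₂ + (2 + n) * v₁)
      ≡⟨ solve (n ∷ n₀ ∷ v₀ ∷ v₁ ∷ v₂ ∷ []) ⟩
    2 * (0 * (suc n * suc n)) + n₀ * (0 * v₀) + 2 * (suc n * (2 + n)) * (1 * v₁) + suc n * suc n * (2 * v₂)
      ≡⟨ cong₂ (λ a b → 2 * (0 * (suc n * suc n)) + n₀ * (0 * v₀) + a * (1 * v₁) + b * (2 * v₂))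
               (sym n₁≡) (sym n₂≡) ⟩
    2 * (0 * (suc n * suc n)) + n₀ * (0 * v₀) + n₁ * (1 * v₁) + n₂ * (2 * v₂)
      ≡⟨ adj-moment ⟩
    (n + n * suc n) * (suc n * suc n) + (n + n * suc n) * (suc n * suc n)
      ≡⟨ solve (n ∷ []) ⟩
    2 * suc n * (n * (n + 2) * suc n) ∎)
  reduced-moment₁ : (3 + n) * v₀ + (2 + n) * v₁ + 2 * suc n + n * (n + 2) * suc n ≡ suc n * (2 * suc n + 1) * suc n
  reduced-moment₁ = *-cancelˡ-≡ _ _ (suc n) (begin
    suc n * ((3 + n) * v₀ + (2 + n) * v₁ + 2 * suc n + n * (n + 2) * suc n)
      ≡⟨ cong (λ a → suc n * ((3 + n) * v₀ + (2 + n) * v₁ + 2 * suc n + a)) (sym reduced-adj-moment) ⟩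
    suc n * ((3 + n) * v₀ + (2 + n) * v₁ + 2 * suc n + (suc n * v₂ + (2 + n) * v₁))
      ≡⟨ solve (n ∷ v₀ ∷ v₁ ∷ v₂ ∷ []) ⟩
    2 * (suc n * suc n) + suc n * (3 + n) * v₀ + 2 * (suc n * (2 + n)) * v₁ + suc n * suc n * v₂
      ≡⟨ cong₃ (λ a b c → 2 * (suc n * suc n) + a * v₀ + b * v₁ + c * v₂) (sym n₀≡) (sym n₁≡) (sym n₂≡) ⟩
    2 * (suc n * suc n) + n₀ * v₀ + n₁ * v₁ + n₂ * v₂
      ≡⟨ moment₁ ⟩
    suc n * (2 * suc n + 1) * (suc n * suc n)
      ≡⟨ solve (n ∷ []) ⟩
    suc n * (suc n * (2 * suc n + 1) * suc n) ∎)

-- Here m = 2 + n and d = 3 + n = m + 1 is odd; these are the first-moment equations of an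
-- adjacent pair with common factors divided out. The first forces v₁ = j (m - 1) with j < m, and
-- then the second forces d ∣ 2 j, so j = 0.
adjacent-system-solution : ∀ n v₀ v₁ v₂ → Coprime (3 + n) 2 →
  suc n * suc v₂ + (2 + n) * v₁ ≡ suc n * (3 + n) * suc n →
  (3 + n) * v₀ + (2 + n) * v₁ + suc n + suc n * (suc n * (3 + n)) ≡ suc n * ((2 + n) * (2 * (2 + n) + 1)) →
  v₀ ≡ suc n * (2 + n) × v₁ ≡ 0 × v₂ ≡ n * (n + 4) + 2
adjacent-system-solution n v₀ v₁ v₂ d-odd e₁ e₂
  with suc n ∣ v₁ ∋ coprime-divisor (coprime-suc (suc n)) (∣m+n∣m⇒∣n (divides (suc n * (3 + n)) e₁) (m∣m*n (suc v₂)))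
... | divides j refl = v₀≡ , cong (_* suc n) j≡0 , v₂≡
  where
  cancelled : suc v₂ + (2 + n) * j ≡ suc n * (3 + n)
  cancelled = *-cancelˡ-≡ _ _ (suc n) (begin
    suc n * (suc v₂ + (2 + n) * j)         ≡⟨ solve (n ∷ v₂ ∷ j ∷ []) ⟩
    suc n * suc v₂ + (2 + n) * (j * suc n) ≡⟨ e₁ ⟩
    suc n * (3 + n) * suc n                ≡⟨ *-comm (suc n * (3 + n)) (suc n) ⟩
    suc n * (suc n * (3 + n))              ∎)
  j<d : j < 3 + n
  j<d = m≤n⇒m≤1+n (*-cancelˡ-< (2 + n) j (2 + n) (subst (suc ((2 + n) * j) ≤_) m²≡
          (≤-trans (subst (suc ((2 + n) * j) ≤_) cancelled (s≤s (m≤n+m _ v₂))) (n≤1+n _))))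
    where
    m²≡ : suc (suc n * (3 + n)) ≡ (2 + n) * (2 + n)
    m²≡ = solve (n ∷ [])
  reduced : (3 + n) * (v₀ + n * j) + 2 * j ≡ (3 + n) * (suc n * (2 + n))
  reduced = +-cancelʳ-≡ (suc n + suc n * (suc n * (3 + n))) _ _ (begin
    (3 + n) * (v₀ + n * j) + 2 * j + (suc n + suc n * (suc n * (3 + n)))
      ≡⟨ solve (n ∷ v₀ ∷ j ∷ []) ⟩
    (3 + n) * v₀ + (2 + n) * (j * suc n) + suc n + suc n * (suc n * (3 + n))
      ≡⟨ e₂ ⟩
    suc n * ((2 + n) * (2 * (2 + n) + 1))
      ≡⟨ solve (n ∷ []) ⟩
    (3 + n) * (suc n * (2 + n)) + (suc n + suc n * (suc n * (3 + n))) ∎)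
  j≡0 : j ≡ 0
  j≡0 = ∣∧<⇒≡0 j (coprime-divisor d-odd
          (∣m+n∣m⇒∣n (divides (suc n * (2 + n)) (trans reduced (*-comm (3 + n) _))) (m∣m*n (v₀ + n * j)))) j<d
  v₀≡ : v₀ ≡ suc n * (2 + n)
  v₀≡ = *-cancelˡ-≡ _ _ (3 + n) (begin
    (3 + n) * v₀                           ≡⟨ solve (n ∷ v₀ ∷ []) ⟩
    (3 + n) * (v₀ + n * 0) + 2 * 0         ≡⟨ subst (λ i → (3 + n) * (v₀ + n * i) + 2 * i ≡ _) j≡0 reduced ⟩
    (3 + n) * (suc n * (2 + n))            ∎)
  v₂≡ : v₂ ≡ n * (n + 4) + 2
  v₂≡ = suc-injective (begin
    suc v₂                                 ≡⟨ solve (v₂ ∷ n ∷ []) ⟩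
    suc v₂ + (2 + n) * 0                   ≡⟨ subst (λ i → suc v₂ + (2 + n) * i ≡ _) j≡0 cancelled ⟩
    suc n * (3 + n)                        ≡⟨ solve (n ∷ []) ⟩
    suc (n * (n + 4) + 2)                  ∎)

adjacent-classes : ∀ n → Coprime (3 + n) 2 → (counts : ValencyCountsₘ (2 + n) 1 ((2 + n) * (2 + n) ∸ 1)) →
  let open ValencyCounts counts in
  n₀ ≡ (3 + n) * (3 + n) × n₁ ≡ 2 * ((2 + n) * (3 + n)) × n₂ ≡ suc n * (3 + n) ×
  val₀ ≡ suc n * (2 + n) × val₁ ≡ 0 × val₂ ≡ n * (n + 4) + 2
adjacent-classes n d-odd record
  { n₀ = n₀ ; n₁ = n₁ ; n₂ = n₂ ; val₀ = v₀ ; val₁ = v₁ ; val₂ = v₂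
  ; order = order ; degrees = degrees ; common = common ; moment₁ = moment₁ ; adj-moment = adj-moment }
  = n₀≡ , n₁≡ , n₂≡ , adjacent-system-solution n v₀ v₁ v₂ d-odd reduced-adj-moment reduced-moment₁
  where
  n₂≡ : n₂ ≡ suc n * (3 + n)
  n₂≡ = begin
    n₂                                         ≡⟨ solve (n₀ ∷ n₁ ∷ n₂ ∷ []) ⟩
    2 * 0 + n₀ * 0 + n₁ * 0 + n₂ * 1           ≡⟨ common ⟩
    suc n + suc n * suc (suc n)                ≡⟨ solve (n ∷ []) ⟩
    suc n * (3 + n)                            ∎
  n₁≡ : n₁ ≡ 2 * ((2 + n) * (3 + n))
  n₁≡ = +-cancelʳ-≡ (2 + 2 * n₂) _ _ (begin
    n₁ + (2 + 2 * n₂)                          ≡⟨ solve (n₀ ∷ n₁ ∷ n₂ ∷ []) ⟩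
    2 * 1 + n₀ * 0 + n₁ * 1 + n₂ * 2           ≡⟨ degrees ⟩
    suc (suc n) * (2 * suc (suc n) + 1) + suc (suc n) * (2 * suc (suc n) + 1)
                                               ≡⟨ solve (n ∷ []) ⟩
    2 * ((2 + n) * (3 + n)) + (2 + 2 * (suc n * (3 + n)))
                                               ≡⟨ cong (λ a → 2 * ((2 + n) * (3 + n)) + (2 + 2 * a)) (sym n₂≡) ⟩
    2 * ((2 + n) * (3 + n)) + (2 + 2 * n₂)     ∎)
  n₀≡ : n₀ ≡ (3 + n) * (3 + n)
  n₀≡ = +-cancelʳ-≡ (2 + n₁ + n₂) _ _ (begin
    n₀ + (2 + n₁ + n₂)                         ≡⟨ solve (n₀ ∷ n₁ ∷ n₂ ∷ []) ⟩
    2 * 1 + n₀ * 1 + n₁ * 1 + n₂ * 1           ≡⟨ order ⟩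
    (2 * suc (suc n) * suc (suc n) + 2 * suc (suc n) + 1) + (2 * suc (suc n) * suc (suc n) + 2 * suc (suc n) + 1)
                                               ≡⟨ solve (n ∷ []) ⟩
    (3 + n) * (3 + n) + (2 + 2 * ((2 + n) * (3 + n)) + suc n * (3 + n))
                                               ≡⟨ cong₂ (λ a b → (3 + n) * (3 + n) + (2 + a + b)) (sym n₁≡) (sym n₂≡) ⟩
    (3 + n) * (3 + n) + (2 + n₁ + n₂)          ∎)
  reduced-adj-moment : suc n * suc v₂ + (2 + n) * v₁ ≡ suc n * (3 + n) * suc n
  reduced-adj-moment = *-cancelˡ-≡ _ _ (2 * (3 + n)) (begin
    2 * (3 + n) * (suc n * suc v₂ + (2 + n) * v₁)
      ≡⟨ solve (n ∷ n₀ ∷ v₀ ∷ v₁ ∷ v₂ ∷ []) ⟩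
    2 * (1 * (suc n + suc n * suc (suc n))) + n₀ * (0 * v₀) + 2 * ((2 + n) * (3 + n)) * (1 * v₁) + suc n * (3 + n) * (2 * v₂)
      ≡⟨ cong₂ (λ a b → 2 * (1 * (suc n + suc n * suc (suc n))) + n₀ * (0 * v₀) + a * (1 * v₁) + b * (2 * v₂))
               (sym n₁≡) (sym n₂≡) ⟩
    2 * (1 * (suc n + suc n * suc (suc n))) + n₀ * (0 * v₀) + n₁ * (1 * v₁) + n₂ * (2 * v₂)
      ≡⟨ adj-moment ⟩
    (suc n + suc n * suc (suc n)) * (suc n + suc n * suc (suc n)) + (suc n + suc n * suc (suc n)) * (suc n + suc n * suc (suc n))
      ≡⟨ solve (n ∷ []) ⟩
    2 * (3 + n) * (suc n * (3 + n) * suc n) ∎)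
  reduced-moment₁ : (3 + n) * v₀ + (2 + n) * v₁ + suc n + suc n * (suc n * (3 + n)) ≡ suc n * ((2 + n) * (2 * (2 + n) + 1))
  reduced-moment₁ = *-cancelˡ-≡ _ _ (3 + n) (+-cancelʳ-≡ ((3 + n) * (suc n * (3 + n) * suc n)) _ _ (begin
    (3 + n) * ((3 + n) * v₀ + (2 + n) * v₁ + suc n + suc n * (suc n * (3 + n))) + (3 + n) * (suc n * (3 + n) * suc n)
      ≡⟨ cong (λ a → (3 + n) * ((3 + n) * v₀ + (2 + n) * v₁ + suc n + suc n * (suc n * (3 + n))) + (3 + n) * a)
              (sym reduced-adj-moment) ⟩
    (3 + n) * ((3 + n) * v₀ + (2 + n) * v₁ + suc n + suc n * (suc n * (3 + n))) + (3 + n) * (suc n * suc v₂ + (2 + n) * v₁)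
      ≡⟨ solve (n ∷ v₀ ∷ v₁ ∷ v₂ ∷ []) ⟩
    2 * (suc n + suc n * suc (suc n)) + (3 + n) * (3 + n) * v₀ + 2 * ((2 + n) * (3 + n)) * v₁ + suc n * (3 + n) * v₂
      + (3 + n) * (suc n * (3 + n) * suc n)
      ≡⟨ cong (_+ (3 + n) * (suc n * (3 + n) * suc n))
              (cong₃ (λ a b c → 2 * (suc n + suc n * suc (suc n)) + a * v₀ + b * v₁ + c * v₂)
                     (sym n₀≡) (sym n₁≡) (sym n₂≡)) ⟩
    2 * (suc n + suc n * suc (suc n)) + n₀ * v₀ + n₁ * v₁ + n₂ * v₂ + (3 + n) * (suc n * (3 + n) * suc n)
      ≡⟨ cong (_+ (3 + n) * (suc n * (3 + n) * suc n)) moment₁ ⟩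
    suc (suc n) * (2 * suc (suc n) + 1) * (suc n + suc n * suc (suc n)) + (3 + n) * (suc n * (3 + n) * suc n)
      ≡⟨ solve (n ∷ []) ⟩
    (3 + n) * (suc n * ((2 + n) * (2 * (2 + n) + 1))) + (3 + n) * (suc n * (3 + n) * suc n) ∎))

-- The hypotheses are the class data found by adjacent-classes, the equation is moment₂.
adjacent-second-moment-excess : ∀ n {n₀ n₁ n₂ v₀ v₁ v₂} →
  n₀ ≡ (3 + n) * (3 + n) × n₁ ≡ 2 * ((2 + n) * (3 + n)) × n₂ ≡ suc n * (3 + n) ×
  v₀ ≡ suc n * (2 + n) × v₁ ≡ 0 × v₂ ≡ n * (n + 4) + 2 →
  let m = 2 + n ; c = suc n + suc n * suc (suc n) ; k = m * (2 * m + 1) ; μ = m * m in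
  2 * (c * c) + n₀ * (v₀ * v₀) + n₁ * (v₁ * v₁) + n₂ * (v₂ * v₂)
    + μ * (2 * (0 * (1 + c)) + n₀ * (0 * (1 + v₀)) + n₁ * (0 * (1 + v₁)) + n₂ * (1 * (1 + v₂)))
  ≡ 2 * (0 * (k + c * c + μ * c)) + n₀ * (0 * (k + c * v₀ + μ * c)) + n₁ * (0 * (k + c * v₁ + μ * c))
      + n₂ * (1 * (k + c * v₂ + μ * c))
    + c * m * (m + 1) * suc (n * n + 3 * n)
adjacent-second-moment-excess n (refl , refl , refl , refl , refl , refl) = solve (n ∷ [])

¬ValencyCounts-adjacent : ∀ n → Coprime (3 + n) 2 → ¬ ValencyCountsₘ (2 + n) 1 ((2 + n) * (2 + n) ∸ 1)
¬ValencyCounts-adjacent n d-odd counts@record { moment₂ = moment₂ } =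
  m+1+n≢m _ (trans (sym (adjacent-second-moment-excess n (adjacent-classes n d-odd counts))) moment₂)

odd⊎even : ∀ m → m ≥ 1 → (∃ λ h → m ≡ suc (h + h)) ⊎ (∃ λ g → m ≡ suc (suc (g + g)))
odd⊎even (suc zero)          _ = inj₁ (0 , refl)
odd⊎even (suc (suc zero))    _ = inj₂ (0 , refl)
odd⊎even (suc (suc (suc m))) _ with odd⊎even (suc m) (s≤s z≤n)
... | inj₁ (h , refl) = inj₁ (suc h , cong (suc ∘ suc) (sym (+-suc h h)))
... | inj₂ (g , refl) = inj₂ (suc g , cong (suc ∘ suc ∘ suc) (sym (+-suc g g)))

proposition4p2 : (m : ℕ) → m ≥ 1 →
    (adj : Adjacency ((2 * m * m + 2 * m + 1) + (2 * m * m + 2 * m + 1))) →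
    IsGraph adj →
    IsSRG adj (m * (2 * m + 1)) (m * m ∸ 1) (m * m) →
    IsBicirculant (2 * m * m + 2 * m + 1) adj →
    (x : Fin ((2 * m * m + 2 * m + 1) + (2 * m * m + 2 * m + 1))) →
    ¬ LocallyThreeIsoregular adj x
proposition4p2 m m≥1 adj graph srg _ x (y , z , x~y , z≢x , x≁z , isoregular-xy , isoregular-xz)
  with odd⊎even m m≥1
... | inj₁ (h , refl) =
  ¬ValencyCounts-nonadjacent (h + h) (coprime-odd-2 h)
    (subst₂ (ValencyCounts _ _ _ _) (cong χ x≁z) (IsSRG.nonadjμ srg x z (z≢x ∘ sym) x≁z)
            (valencyCounts graph srg isoregular-xz))
... | inj₂ (g , refl) =
  ¬ValencyCounts-adjacent (g + g) (coprime-odd-2 g)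
    (subst₂ (ValencyCounts _ _ _ _) (cong χ x~y) (IsSRG.adjacentλ srg x y x~y)
            (valencyCounts graph srg isoregular-xy))
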